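{- Let $G=(V,E)$ be a graph in which every node has a strict preference order over its neighbours, and let $G'$ be its bidirected graph. If $G$ admits a strongly dominant matching, then $G'$ admits a stable matching.
   Context: The bidirected graph $G'$ has node set $V$ and, for each edge $(u,v)\in E$, two arcs: one from $u$ to $v$, written $(u^+,v^-)$, and one from $v$ to $u$, written $(u^-,v^+)$ (equivalently $(v^+,u^-)$). From the point of view of $u$, the arc $(u^+,v^-)$ is the neighbour token $v^-$ and the arc $(u^-,v^+)$ is the token $v^+$. If $u$'s preference list in $G$ is $v_1\succ\cdots\succ v_k$, its preference list in $G'$ is $v_1^-\succ\cdots\succ v_k^-\succ v_1^+\succ\cdots\succ v_k^+$. A matching $M'$ in $G'$ is a set of arcs such that every node is incident to at most one arc of $M'$. $M'$ is stable in $G'$ if for every arc $(u^+,v^-)\notin M'$, either $u$ is matched in $M'$ to a token it ranks better than $v^-$, or $v$ is matched in $M'$ to a token it ranks better than $u^+$. For a matching $M$ of $G$ (with $M(u)$ the partner of $u$; an unmatched node prefers any neighbour to being unmatched), the label of $(u,v)\in E\setminus M$ at $u$ is $+$ if $u$ is unmatched or prefers $v$ to $M(u)$, and $-$ otherwise; $(+,+)$ and $(-,-)$ edges have both labels $+$, resp. $-$. $M$ is strongly dominant in $G$ if there is a partition $(L,R)$ of $V$ with (i) every edge of $M$ joining $L$ and $R$, (ii) every node of $R$ matched in $M$, (iii) every $(+,+)$ edge having both endpoints in $R$, (iv) every edge with both endpoints in $L$ being $(-,-)$. -}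

module Defs where

open import Data.Nat using (ℕ)
open import Data.Fin using (Fin)
open import Data.Bool using (Bool; true; false)
open import Data.Maybe using (Maybe; just; nothing)
open import Data.List using (List; _++_; _∷_; map)
open import Data.List.Membership.Propositional using (_∈_; _∉_)
open import Data.List.Relation.Unary.Unique.Propositional using (Unique)
open import Data.Product using (Σ; ∃; ∃-syntax; _×_; _,_)
open import Data.Sum using (_⊎_)
open import Relation.Binary.PropositionalEquality using (_≡_; _≢_)
open import Relation.Nullary using (¬_)

Before : {A : Set} → List A → A → A → Set
Before {A} l a b = Σ (List A) λ xs → Σ (List A) λ ys → (l ≡ xs ++ (a ∷ ys)) × (b ∈ ys)

-- A graph on nodes Fin n where each node has a strict preference list over
-- its neighbours (best first).
record Instance (n : ℕ) : Set where
  field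
    pref      : Fin n → List (Fin n)
    unique    : ∀ u → Unique (pref u)
    loopless  : ∀ u → u ∉ pref u
    symmetric : ∀ u v → v ∈ pref u → u ∈ pref v

module _ {n : ℕ} (G : Instance n) where
  open Instance G

  Adj : Fin n → Fin n → Set
  Adj u v = v ∈ pref u

  IsMatching : (Fin n → Maybe (Fin n)) → Set
  IsMatching M = ∀ u v → M u ≡ just v → Adj u v × M v ≡ just u

  -- label of edge (u,v) at u is + : u unmatched or prefers v to M(u)
  PlusAt : (Fin n → Maybe (Fin n)) → Fin n → Fin n → Set
  PlusAt M u v = (M u ≡ nothing) ⊎ (∃[ w ] (M u ≡ just w × Before (pref u) v w))

  -- side u ≡ true means u ∈ R, side u ≡ false means u ∈ L
  StronglyDominant : (Fin n → Maybe (Fin n)) → Set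
  StronglyDominant M = Σ (Fin n → Bool) λ side →
      ( (∀ u v → M u ≡ just v → side u ≢ side v)
      × (∀ u → side u ≡ true → M u ≢ nothing)
      × (∀ u v → Adj u v → M u ≢ just v → PlusAt M u v → PlusAt M v u
               → side u ≡ true × side v ≡ true)
      × (∀ u v → Adj u v → side u ≡ false → side v ≡ false
               → M u ≢ just v × ¬ PlusAt M u v × ¬ PlusAt M v u) )

  data Sign : Set where
    plus minus : Sign

  -- token (v , minus) at u = arc (u⁺ , v⁻);  token (v , plus) at u = arc (u⁻ , v⁺)
  Token : Set
  Token = Fin n × Sign

  flipSign : Sign → Sign
  flipSign plus = minus
  flipSign minus = plus

  prefTok : Fin n → List Token
  prefTok u = map (λ v → (v , minus)) (pref u) ++ map (λ v → (v , plus)) (pref u)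

  -- A matching in G' as a partner-token function: M' u ≡ just (v , s) means
  -- u is incident to the arc that u sees as token v^s; the same arc is seen
  -- by v as token u^(flip s). Functionality = each node in at most one arc.
  IsMatching' : (Fin n → Maybe Token) → Set
  IsMatching' M' = ∀ u v s → M' u ≡ just (v , s)
                   → Adj u v × M' v ≡ just (u , flipSign s)

  Stable' : (Fin n → Maybe Token) → Set
  Stable' M' = ∀ u v → Adj u v → M' u ≢ just (v , minus)
             → (∃[ t ] (M' u ≡ just t × Before (prefTok u) t (v , minus)))
             ⊎ (∃[ t ] (M' v ≡ just t × Before (prefTok v) t (u , plus)))

module Submission where

open import Defs
open import Data.Nat using (ℕ)
open import Data.Fin using (Fin)
open import Data.Bool using (Bool; true; false)
open import Data.Maybe using (Maybe; just; nothing)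
import Data.Maybe as Maybe
open import Data.List using ([]; _∷_; _++_; map)
open import Data.List.Properties using (map-++; ++-assoc)
open import Data.List.Membership.Propositional using (_∈_)
open import Data.List.Membership.Propositional.Properties using (∈-map⁺; ∈-++⁺ˡ; ∈-++⁺ʳ; ∈-∃++)
open import Data.List.Relation.Unary.Any using (here; there)
open import Data.List.Relation.Unary.Unique.Propositional using (Unique)
open import Data.List.Relation.Unary.AllPairs using (_∷_)
open import Data.Product using (∃-syntax; _×_; _,_; proj₁; proj₂)
open import Data.Sum using (_⊎_; inj₁; inj₂)
open import Data.Empty using (⊥-elim)
open import Relation.Nullary using (¬_)
open import Relation.Binary.PropositionalEquality using (_≡_; _≢_; refl; sym; trans; cong)

-- Orient every edge of the strongly dominant matching M from its R-end to its L-end.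
-- An R-node then holds a minus token, which beats every plus token, so arcs into R are
-- blocked; arcs inside L are (-,-) edges, blocked by the L-endpoint's partner; and an arc
-- from R to L that its R-end prefers to its partner is a (+,-) edge, since (+,+) edges lie
-- inside R, so again the L-end's partner blocks it.

module _ {A : Set} where

  Before-∷ : ∀ {x l} {a b : A} → Before l a b → Before (x ∷ l) a b
  Before-∷ {x} (p , q , eq , b∈q) = x ∷ p , q , cong (x ∷_) eq , b∈q

  Before-trichotomy : ∀ l → Unique l → ∀ {a b : A} → a ∈ l → b ∈ l → a ≢ b
                    → Before l a b ⊎ Before l b a
  Before-trichotomy (x ∷ xs) _ (here refl) (here refl) a≢b = ⊥-elim (a≢b refl)
  Before-trichotomy (x ∷ xs) _ (here refl) (there b∈xs) _ = inj₁ ([] , xs , refl , b∈xs)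
  Before-trichotomy (x ∷ xs) _ (there a∈xs) (here refl) _ = inj₂ ([] , xs , refl , a∈xs)
  Before-trichotomy (x ∷ xs) (_ ∷ u) (there a∈xs) (there b∈xs) a≢b
    with Before-trichotomy xs u a∈xs b∈xs a≢b
  ... | inj₁ a<b = inj₁ (Before-∷ a<b)
  ... | inj₂ b<a = inj₂ (Before-∷ b<a)

  Before-++⁺ˡ : ∀ {l} r {a b : A} → Before l a b → Before (l ++ r) a b
  Before-++⁺ˡ r (p , q , refl , b∈q) = p , q ++ r , ++-assoc p (_ ∷ q) r , ∈-++⁺ˡ b∈q

  Before-++⁺ʳ : ∀ l {r} {a b : A} → Before r a b → Before (l ++ r) a b
  Before-++⁺ʳ l (p , q , refl , b∈q) = l ++ p , q , sym (++-assoc l p _) , b∈q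

  Before-++-across : ∀ {l} r {a b : A} → a ∈ l → b ∈ r → Before (l ++ r) a b
  Before-++-across r a∈l b∈r with ∈-∃++ a∈l
  ... | p , q , refl = p , q ++ r , ++-assoc p (_ ∷ q) r , ∈-++⁺ʳ q b∈r

Before-map⁺ : ∀ {A B : Set} (f : A → B) {l} {a b : A} → Before l a b → Before (map f l) (f a) (f b)
Before-map⁺ f (p , q , refl , b∈q) = map f p , map f q , map-++ f p (_ ∷ q) , ∈-map⁺ f b∈q

module _ {n : ℕ} (G : Instance n) where
  open Instance G

  minus-before-plus : ∀ {v x u} → x ∈ pref v → u ∈ pref v
                    → Before (prefTok G v) (x , minus) (u , plus)
  minus-before-plus x∈ u∈ = Before-++-across _ (∈-map⁺ _ x∈) (∈-map⁺ _ u∈)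

  Before-minus : ∀ {v x u} → Before (pref v) x u → Before (prefTok G v) (x , minus) (u , minus)
  Before-minus x<u = Before-++⁺ˡ _ (Before-map⁺ _ x<u)

  Before-plus : ∀ {v x u} → Before (pref v) x u → Before (prefTok G v) (x , plus) (u , plus)
  Before-plus x<u = Before-++⁺ʳ _ (Before-map⁺ _ x<u)

  module _ {M : Fin n → Maybe (Fin n)} (isM : IsMatching G M) where

    unmatched-edge-sym : ∀ {u v} → M u ≢ just v → M v ≢ just u
    unmatched-edge-sym u≁v Mv≡u = u≁v (proj₂ (isM _ _ Mv≡u))

    ¬PlusAt⇒partner-preferred : ∀ {v u} → Adj G v u → M v ≢ just u → ¬ PlusAt G M v u
                              → ∃[ x ] (M v ≡ just x × Before (pref v) x u)
    ¬PlusAt⇒partner-preferred {v} {u} vu v≁u ¬plus with M v in e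
    ... | nothing = ⊥-elim (¬plus (inj₁ refl))
    ... | just x with Before-trichotomy (pref v) (unique v) (proj₁ (isM v x e)) vu (λ { refl → v≁u refl })
    ...   | inj₁ x<u = x , refl , x<u
    ...   | inj₂ u<x = ⊥-elim (¬plus (inj₂ (x , refl , u<x)))

module FromStronglyDominant {n : ℕ} (G : Instance n)
  {M : Fin n → Maybe (Fin n)} (isM : IsMatching G M) (side : Fin n → Bool)
  (matched-across : ∀ u v → M u ≡ just v → side u ≢ side v)
  (R-matched : ∀ u → side u ≡ true → M u ≢ nothing)
  (plusplus-in-R : ∀ u v → Adj G u v → M u ≢ just v → PlusAt G M u v → PlusAt G M v u
                 → side u ≡ true × side v ≡ true)
  (LL-minusminus : ∀ u v → Adj G u v → side u ≡ false → side v ≡ false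
                 → M u ≢ just v × ¬ PlusAt G M u v × ¬ PlusAt G M v u) where
  open Instance G

  sideSign : Bool → Sign G
  sideSign true = minus
  sideSign false = plus

  sideSign-≢ : ∀ {a b} → a ≢ b → sideSign b ≡ flipSign G (sideSign a)
  sideSign-≢ {true} {true} a≢b = ⊥-elim (a≢b refl)
  sideSign-≢ {true} {false} _ = refl
  sideSign-≢ {false} {true} _ = refl
  sideSign-≢ {false} {false} a≢b = ⊥-elim (a≢b refl)

  M' : Fin n → Maybe (Token G)
  M' u = Maybe.map (λ w → w , sideSign (side u)) (M u)

  M'-R : ∀ {u w} → side u ≡ true → M u ≡ just w → M' u ≡ just (w , minus)
  M'-R su e rewrite e | su = refl

  M'-L : ∀ {u w} → side u ≡ false → M u ≡ just w → M' u ≡ just (w , plus)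
  M'-L su e rewrite e | su = refl

  isMatching' : IsMatching' G M'
  isMatching' u v s eq with M u in e
  isMatching' u v s refl | just w with isM u w e
  ... | uw , Mw≡u rewrite Mw≡u = uw , cong (λ s → just (u , s)) (sideSign-≢ (matched-across u w e))

  Blocks : Fin n → Token G → Set
  Blocks v t = ∃[ t' ] (M' v ≡ just t' × Before (prefTok G v) t' t)

  partner-of-R : ∀ {v} → side v ≡ true → ∃[ x ] (M v ≡ just x)
  partner-of-R {v} sv with M v in e
  ... | nothing = ⊥-elim (R-matched v sv e)
  ... | just x = x , refl

  R-blocks-plus : ∀ {v u} → side v ≡ true → Adj G v u → Blocks v (u , plus)
  R-blocks-plus {v} sv vu with partner-of-R sv
  ... | x , e = (x , minus) , M'-R sv e , minus-before-plus G (proj₁ (isM v x e)) vu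

  L-blocks-plus : ∀ {v u} → side v ≡ false → Adj G v u → M v ≢ just u → ¬ PlusAt G M v u
                → Blocks v (u , plus)
  L-blocks-plus sv vu v≁u ¬plus with ¬PlusAt⇒partner-preferred G isM vu v≁u ¬plus
  ... | x , e , x<u = (x , plus) , M'-L sv e , Before-plus G x<u

  RL-blocked : ∀ {u v} → side u ≡ true → side v ≡ false → Adj G u v
             → M' u ≢ just (v , minus) → Blocks u (v , minus) ⊎ Blocks v (u , plus)
  RL-blocked {u} {v} su sv uv arc∉M' with partner-of-R su
  ... | w , e = by-rank (Before-trichotomy (pref u) (unique u) (proj₁ (isM u w e)) uv w≢v)
    where
      u≁v : M u ≢ just v
      u≁v Mu≡v = arc∉M' (M'-R su Mu≡v)

      w≢v : w ≢ v
      w≢v refl = u≁v e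

      by-rank : Before (pref u) w v ⊎ Before (pref u) v w → Blocks u (v , minus) ⊎ Blocks v (u , plus)
      by-rank (inj₁ w<v) = inj₁ ((w , minus) , M'-R su e , Before-minus G w<v)
      by-rank (inj₂ v<w) = inj₂ (L-blocks-plus sv (symmetric u v uv) (unmatched-edge-sym G isM u≁v) ¬plus)
        where
          ¬plus : ¬ PlusAt G M v u
          ¬plus v-plus with trans (sym sv) (proj₂ (plusplus-in-R u v uv u≁v (inj₂ (w , e , v<w)) v-plus))
          ... | ()

  stable : Stable' G M'
  stable u v uv arc∉M' = by-sides (side u) (side v) refl refl
    where
      by-sides : ∀ a b → side u ≡ a → side v ≡ b → Blocks u (v , minus) ⊎ Blocks v (u , plus)
      by-sides _     true  _  sv = inj₂ (R-blocks-plus sv (symmetric u v uv))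
      by-sides true  false su sv = RL-blocked su sv uv arc∉M'
      by-sides false false su sv =
        let u≁v , _ , ¬plus = LL-minusminus u v uv su sv
        in inj₂ (L-blocks-plus sv (symmetric u v uv) (unmatched-edge-sym G isM u≁v) ¬plus)

lemma5 : (n : ℕ) (G : Instance n)
         → ∃[ M ] (IsMatching G M × StronglyDominant G M)
         → ∃[ M' ] (IsMatching' G M' × Stable' G M')
lemma5 n G (M , isM , side , matched-across , R-matched , plusplus-in-R , LL-minusminus) =
  M' , isMatching' , stable
  where open FromStronglyDominant G isM side matched-across R-matched plusplus-in-R LL-minusminus
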